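{- Let $m$ be a positive even integer and $t$ a positive integer with $t<\frac{m}{2}$. Let $A, B\subseteq \mathbb{Z}_{m}$ with $A\cup B=\mathbb{Z}_{m}$ and $|A\cap B|=2t$. If $R_{A}(\overline{n})=R_{B}(\overline{n})$ for all $\overline{n}\in \mathbb{Z}_{m}$, then $|A|=|B|=\frac{m}{2}+t$.
   Context: $\mathbb{Z}_m$ denotes the set (group) of residue classes modulo $m$. For $A\subseteq\mathbb{Z}_m$ and $\overline{n}\in\mathbb{Z}_m$, $R_A(\overline{n})$ is the number of ordered pairs $(\overline{a},\overline{a'})\in A\times A$ with $\overline{a}+\overline{a'}=\overline{n}$. -}

module Defs where

open import Data.Nat using (ℕ; zero; suc; NonZero; _+_)
open import Data.Nat.DivMod using (_%_; m%n<n)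
open import Data.Fin using (Fin; toℕ; fromℕ<)
open import Data.Fin.Subset using (Subset; _∈_)
open import Data.Fin.Subset.Properties using (_∈?_)
open import Data.List using (List; length; filter; cartesianProduct; allFin)
open import Data.Product using (_×_; _,_; proj₁; proj₂)
open import Relation.Binary.PropositionalEquality using (_≡_)
open import Relation.Nullary using (Dec; _×-dec_)
open import Data.Fin.Properties using (_≟_)

-- ℤ_m is modelled as Fin m; addition of residue classes is addition mod m.
_⊕_ : ∀ {m} .{{_ : NonZero m}} → Fin m → Fin m → Fin m
_⊕_ {m} a b = fromℕ< (m%n<n (toℕ a + toℕ b) m)

R : ∀ {m} .{{_ : NonZero m}} → Subset m → Fin m → ℕ
R {m} A n = length (filter P? (cartesianProduct (allFin m) (allFin m)))
  where
  P? : (p : Fin m × Fin m) → Dec ((proj₁ p ∈ A × proj₂ p ∈ A) × (proj₁ p ⊕ proj₂ p) ≡ n)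
  P? (a , a') = ((a ∈? A) ×-dec (a' ∈? A)) ×-dec ((a ⊕ a') ≟ n)

module Submission where

-- Every ordered
-- pair (a , a') ∈ S × S is counted by R_S at exactly one residue, namely
-- a + a', so summing R_S over all of ℤ_m gives |S|².  Hence R_A = R_B
-- forces |A|² = |B|², i.e. |A| = |B|.  Inclusion–exclusion gives
-- |A ∪ B| + |A ∩ B| = |A| + |B|, i.e. 2k + 2t = 2|A|, so |A| = |B| = k + t.

open import Defs
open import Data.Nat using (ℕ; zero; suc; _+_; _*_; _<_; _≤_; NonZero)
open import Data.Nat.Properties
  using (+-suc; *-distribʳ-+; *-mono-<; <-cmp; <-irrefl; *-distribˡ-+; *-cancelˡ-≡; +-identityʳ; +-0-commutativeMonoid)
import Data.Fin as Fin
open import Data.Fin using (Fin; punchIn)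
open import Data.Fin.Properties using (_≟_; punchInᵢ≢i)
open import Data.Fin.Subset using (Subset; _∈_; _∪_; _∩_; ∣_∣; ⊤; inside; outside)
open import Data.Fin.Subset.Properties using (_∈?_; drop-there; ∣⊤∣≡n)
open import Data.List using (List; []; _∷_; length; filter; map; _++_; cartesianProduct; allFin; tabulate)
open import Data.List.Properties using (filter-++; filter-≐; filter-none; length-++; map-tabulate)
open import Data.List.Relation.Unary.All using (universal)
open import Data.Product using (_×_; _,_; proj₁; proj₂)
open import Data.Bool using (true; false; if_then_else_)
open import Data.Vec using ([]; _∷_; there)
open import Level using (Level)
open import Function using (id)
open import Data.Empty using (⊥-elim)
open import Relation.Unary using (Pred; Decidable)
open import Relation.Nullary using (Dec; yes; no; does; ¬_; _×-dec_)
open import Relation.Nullary.Decidable using (dec-true; dec-false)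
open import Relation.Binary.Definitions using (tri<; tri≈; tri>)
open import Relation.Binary.PropositionalEquality
  using (_≡_; refl; sym; trans; cong; cong₂; module ≡-Reasoning)
open import Algebra.Properties.CommutativeMonoid.Sum +-0-commutativeMonoid
  using (sum-syntax; sum-cong-≗; sum-remove; sum-replicate-zero; ∑-distrib-+)

private
  variable
    a p q : Level
    X Y : Set a

count : {P : Pred X p} → Decidable P → List X → ℕ
count P? xs = length (filter P? xs)

indicator : {P : Set p} → Dec P → ℕ
indicator d = if does d then 1 else 0

indicator-yes : {P : Set p} (d : Dec P) → P → indicator d ≡ 1
indicator-yes d x = cong (λ b → if b then 1 else 0) (dec-true d x)

indicator-no : {P : Set p} (d : Dec P) → ¬ P → indicator d ≡ 0
indicator-no d ¬x = cong (λ b → if b then 1 else 0) (dec-false d ¬x)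

module _ {P : Pred X p} (P? : Decidable P) where

  count-∷ : ∀ x xs → count P? (x ∷ xs) ≡ indicator (P? x) + count P? xs
  count-∷ x xs with does (P? x)
  ... | true  = refl
  ... | false = refl

  count-++ : ∀ xs ys → count P? (xs ++ ys) ≡ count P? xs + count P? ys
  count-++ xs ys = trans (cong length (filter-++ P? xs ys)) (length-++ (filter P? xs))

  count-none : (∀ x → ¬ P x) → ∀ xs → count P? xs ≡ 0
  count-none none xs = cong length (filter-none P? (universal none xs))

  count-map : (f : Y → X) → ∀ ys → count P? (map f ys) ≡ count (λ y → P? (f y)) ys
  count-map f []       = refl
  count-map f (y ∷ ys) with does (P? (f y))
  ... | true  = cong suc (count-map f ys)
  ... | false = count-map f ys

count-≐ : {P : Pred X p} {Q : Pred X q} (P? : Decidable P) (Q? : Decidable Q) →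
  (∀ {x} → P x → Q x) → (∀ {x} → Q x → P x) → ∀ xs → count P? xs ≡ count Q? xs
count-≐ P? Q? P⇒Q Q⇒P xs = cong length (filter-≐ P? Q? (P⇒Q , Q⇒P) xs)

count-× : {P : Pred X p} {Q : Pred Y q} (P? : Decidable P) (Q? : Decidable Q) → ∀ xs ys →
  count (λ z → P? (proj₁ z) ×-dec Q? (proj₂ z)) (cartesianProduct xs ys) ≡ count P? xs * count Q? ys
count-× P? Q? [] ys = refl
count-× {X = X} {Y = Y} {P = P} {Q = Q} P? Q? (x ∷ xs) ys = begin
  count PQ? (map (x ,_) ys ++ cartesianProduct xs ys)
    ≡⟨ count-++ PQ? (map (x ,_) ys) (cartesianProduct xs ys) ⟩
  count PQ? (map (x ,_) ys) + count PQ? (cartesianProduct xs ys)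
    ≡⟨ cong₂ _+_ (count-map PQ? (x ,_) ys) (count-× P? Q? xs ys) ⟩
  count (λ y → P? x ×-dec Q? y) ys + count P? xs * count Q? ys
    ≡⟨ cong (_+ count P? xs * count Q? ys) (row (P? x)) ⟩
  indicator (P? x) * count Q? ys + count P? xs * count Q? ys
    ≡⟨ sym (*-distribʳ-+ (count Q? ys) (indicator (P? x)) (count P? xs)) ⟩
  (indicator (P? x) + count P? xs) * count Q? ys
    ≡⟨ cong (_* count Q? ys) (sym (count-∷ P? x xs)) ⟩
  count P? (x ∷ xs) * count Q? ys ∎
  where
  open ≡-Reasoning
  PQ? : Decidable (λ (z : X × Y) → P (proj₁ z) × Q (proj₂ z))
  PQ? z = P? (proj₁ z) ×-dec Q? (proj₂ z)
  row : (Px? : Dec (P x)) → count (λ y → P? x ×-dec Q? y) ys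
      ≡ indicator Px? * count Q? ys
  row (yes Px) = trans (count-≐ _ Q? proj₂ (Px ,_) ys) (sym (+-identityʳ _))
  row (no ¬Px) = count-none _ (λ y PxQy → ¬Px (proj₁ PxQy)) ys

∑-indicator-≡ : ∀ {m} (i : Fin m) → ∑[ n < m ] indicator (i ≟ n) ≡ 1
∑-indicator-≡ {suc m} i = begin
  ∑[ n < suc m ] indicator (i ≟ n)
    ≡⟨ sum-remove {i = i} (λ n → indicator (i ≟ n)) ⟩
  indicator (i ≟ i) + ∑[ j < m ] indicator (i ≟ punchIn i j)
    ≡⟨ cong₂ _+_ (indicator-yes (i ≟ i) refl) (sum-cong-≗ off-diagonal) ⟩
  1 + ∑[ j < m ] 0
    ≡⟨ cong (1 +_) (sum-replicate-zero m) ⟩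
  1 ∎
  where
  open ≡-Reasoning
  off-diagonal : ∀ j → indicator (i ≟ punchIn i j) ≡ 0
  off-diagonal j = indicator-no (i ≟ punchIn i j) (λ i≡ → punchInᵢ≢i i j (sym i≡))

∑-count-fibres : {D : Pred X p} (D? : Decidable D) {m : ℕ} (f : X → Fin m) → ∀ xs →
  ∑[ n < m ] count (λ x → D? x ×-dec (f x ≟ n)) xs ≡ count D? xs
∑-count-fibres D? {m} f []       = sum-replicate-zero m
∑-count-fibres {D = D} D? {m} f (x ∷ xs) = begin
  ∑[ n < m ] count (fibre? n) (x ∷ xs)
    ≡⟨ sum-cong-≗ (λ n → count-∷ (fibre? n) x xs) ⟩
  ∑[ n < m ] (indicator (fibre? n x) + count (fibre? n) xs)
    ≡⟨ ∑-distrib-+ (λ n → indicator (fibre? n x)) (λ n → count (fibre? n) xs) ⟩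
  ∑[ n < m ] indicator (fibre? n x) + ∑[ n < m ] count (fibre? n) xs
    ≡⟨ cong₂ _+_ (head-contribution (D? x)) (∑-count-fibres D? f xs) ⟩
  indicator (D? x) + count D? xs
    ≡⟨ sym (count-∷ D? x xs) ⟩
  count D? (x ∷ xs) ∎
  where
  open ≡-Reasoning
  fibre? : (n : Fin m) → Decidable (λ x → D x × f x ≡ n)
  fibre? n x = D? x ×-dec (f x ≟ n)
  head-contribution : (Dx? : Dec (D x)) → ∑[ n < m ] indicator (Dx? ×-dec (f x ≟ n)) ≡ indicator Dx?
  head-contribution (yes _) = ∑-indicator-≡ (f x)
  head-contribution (no _)  = sum-replicate-zero m

count-∈ : ∀ {m} (S : Subset m) → count (_∈? S) (allFin m) ≡ ∣ S ∣
count-∈ {zero}  []      = refl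
count-∈ {suc m} (s ∷ S) = begin
  count (_∈? (s ∷ S)) (allFin (suc m))
    ≡⟨ count-∷ (_∈? (s ∷ S)) Fin.zero (tabulate Fin.suc) ⟩
  indicator (Fin.zero ∈? (s ∷ S)) + count (_∈? (s ∷ S)) (tabulate Fin.suc)
    ≡⟨ cong (indicator (Fin.zero ∈? (s ∷ S)) +_) successors ⟩
  indicator (Fin.zero ∈? (s ∷ S)) + ∣ S ∣
    ≡⟨ head-contribution s ⟩
  ∣ s ∷ S ∣ ∎
  where
  open ≡-Reasoning
  successors : count (_∈? (s ∷ S)) (tabulate Fin.suc) ≡ ∣ S ∣
  successors = begin
    count (_∈? (s ∷ S)) (tabulate Fin.suc)
      ≡⟨ cong (count (_∈? (s ∷ S))) (sym (map-tabulate id Fin.suc)) ⟩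
    count (_∈? (s ∷ S)) (map Fin.suc (allFin m))
      ≡⟨ count-map (_∈? (s ∷ S)) Fin.suc (allFin m) ⟩
    count (λ i → Fin.suc i ∈? (s ∷ S)) (allFin m)
      ≡⟨ count-≐ _ (_∈? S) drop-there there (allFin m) ⟩
    count (_∈? S) (allFin m)
      ≡⟨ count-∈ S ⟩
    ∣ S ∣ ∎
  head-contribution : ∀ s → indicator (Fin.zero ∈? (s ∷ S)) + ∣ S ∣ ≡ ∣ s ∷ S ∣
  head-contribution inside  = refl
  head-contribution outside = refl

∣p∪q∣+∣p∩q∣≡∣p∣+∣q∣ : ∀ {m} (P Q : Subset m) → ∣ P ∪ Q ∣ + ∣ P ∩ Q ∣ ≡ ∣ P ∣ + ∣ Q ∣
∣p∪q∣+∣p∩q∣≡∣p∣+∣q∣ []            []            = refl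
∣p∪q∣+∣p∩q∣≡∣p∣+∣q∣ (inside  ∷ P) (inside  ∷ Q) =
  cong suc (trans (+-suc ∣ P ∪ Q ∣ ∣ P ∩ Q ∣)
    (trans (cong suc (∣p∪q∣+∣p∩q∣≡∣p∣+∣q∣ P Q)) (sym (+-suc ∣ P ∣ ∣ Q ∣))))
∣p∪q∣+∣p∩q∣≡∣p∣+∣q∣ (inside  ∷ P) (outside ∷ Q) = cong suc (∣p∪q∣+∣p∩q∣≡∣p∣+∣q∣ P Q)
∣p∪q∣+∣p∩q∣≡∣p∣+∣q∣ (outside ∷ P) (inside  ∷ Q) =
  trans (cong suc (∣p∪q∣+∣p∩q∣≡∣p∣+∣q∣ P Q)) (sym (+-suc ∣ P ∣ ∣ Q ∣))
∣p∪q∣+∣p∩q∣≡∣p∣+∣q∣ (outside ∷ P) (outside ∷ Q) = ∣p∪q∣+∣p∩q∣≡∣p∣+∣q∣ P Q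

-- Every pair of S × S has exactly one sum, so the representation
-- function of S sums to |S|² over ℤ_m.
∑-R : ∀ {m} .{{_ : NonZero m}} (S : Subset m) → ∑[ n < m ] R S n ≡ ∣ S ∣ * ∣ S ∣
∑-R {m} S = begin
  ∑[ n < m ] R S n
    ≡⟨ ∑-count-fibres inS×S? (λ z → proj₁ z ⊕ proj₂ z) (cartesianProduct (allFin m) (allFin m)) ⟩
  count inS×S? (cartesianProduct (allFin m) (allFin m))
    ≡⟨ count-× (_∈? S) (_∈? S) (allFin m) (allFin m) ⟩
  count (_∈? S) (allFin m) * count (_∈? S) (allFin m)
    ≡⟨ cong₂ _*_ (count-∈ S) (count-∈ S) ⟩
  ∣ S ∣ * ∣ S ∣ ∎
  where
  open ≡-Reasoning
  inS×S? : Decidable (λ (z : Fin m × Fin m) → proj₁ z ∈ S × proj₂ z ∈ S)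
  inS×S? z = (proj₁ z ∈? S) ×-dec (proj₂ z ∈? S)

square-injective : ∀ x y → x * x ≡ y * y → x ≡ y
square-injective x y x²≡y² with <-cmp x y
... | tri< x<y _ _ = ⊥-elim (<-irrefl x²≡y² (*-mono-< x<y x<y))
... | tri≈ _ x≡y _ = x≡y
... | tri> _ _ x>y = ⊥-elim (<-irrefl (sym x²≡y²) (*-mono-< x>y x>y))

lemma2p1 : (k t : ℕ) → 1 ≤ k → 1 ≤ t → t < k →
    .{{_ : NonZero (2 * k)}} → (A B : Subset (2 * k)) → A ∪ B ≡ ⊤ → ∣ A ∩ B ∣ ≡ 2 * t →
    ((n : Fin (2 * k)) → R A n ≡ R B n) →
    (∣ A ∣ ≡ k + t) × (∣ B ∣ ≡ k + t)
lemma2p1 k t _ _ _ A B A∪B≡⊤ ∣A∩B∣≡2t R-equal = ∣A∣≡k+t , trans (sym ∣A∣≡∣B∣) ∣A∣≡k+t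
  where
  open ≡-Reasoning
  ∣A∣≡∣B∣ : ∣ A ∣ ≡ ∣ B ∣
  ∣A∣≡∣B∣ = square-injective ∣ A ∣ ∣ B ∣ (begin
    ∣ A ∣ * ∣ A ∣          ≡⟨ sym (∑-R A) ⟩
    ∑[ n < 2 * k ] R A n   ≡⟨ sum-cong-≗ R-equal ⟩
    ∑[ n < 2 * k ] R B n   ≡⟨ ∑-R B ⟩
    ∣ B ∣ * ∣ B ∣          ∎)
  twice : 2 * (k + t) ≡ 2 * ∣ A ∣
  twice = begin
    2 * (k + t)                ≡⟨ *-distribˡ-+ 2 k t ⟩
    2 * k + 2 * t              ≡⟨ cong₂ _+_ (sym (trans (cong ∣_∣ A∪B≡⊤) (∣⊤∣≡n (2 * k)))) (sym ∣A∩B∣≡2t) ⟩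
    ∣ A ∪ B ∣ + ∣ A ∩ B ∣      ≡⟨ ∣p∪q∣+∣p∩q∣≡∣p∣+∣q∣ A B ⟩
    ∣ A ∣ + ∣ B ∣              ≡⟨ cong (∣ A ∣ +_) (sym ∣A∣≡∣B∣) ⟩
    ∣ A ∣ + ∣ A ∣              ≡⟨ cong (∣ A ∣ +_) (sym (+-identityʳ ∣ A ∣)) ⟩
    2 * ∣ A ∣                  ∎
  ∣A∣≡k+t : ∣ A ∣ ≡ k + t
  ∣A∣≡k+t = sym (*-cancelˡ-≡ (k + t) ∣ A ∣ 2 twice)
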